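{- For every integer $n\geq 3$, the helm graph $H_n$ is total prime.
   Context: All graphs are finite and simple. For a graph $G$ with vertex set $V$ and edge set $E$, a total prime labeling is a bijection $\ell: V\cup E\to\{1,2,\ldots,|V|+|E|\}$ such that (i) for every pair of adjacent vertices $u,v$, $\gcd(\ell(u),\ell(v))=1$, and (ii) for every vertex $v$ of degree at least 2, the greatest common divisor of the labels $\ell(uv)$ over all edges $uv$ incident to $v$ equals 1. A graph is total prime if it admits a total prime labeling. The wheel $W_n$ ($n\ge 3$) is obtained from the cycle $C_n$ by adding one central vertex adjacent to every cycle vertex. The helm $H_n$ is obtained from $W_n$ by attaching one new pendant vertex (via a new edge) to each vertex of the outer $n$-cycle. -}

module Defs where

open import Data.Nat using (ℕ; zero; suc; _+_; _≤_; NonZero)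
open import Data.Nat.GCD using (gcd)
open import Data.Nat.Coprimality using (Coprime)
open import Data.Nat.DivMod using (_mod_)
open import Data.Fin using (Fin; toℕ; _↑ˡ_; _↑ʳ_; splitAt; _≟_)
import Data.Fin as F
open import Data.Sum using (_⊎_; inj₁; inj₂)
open import Data.Product using (_×_; _,_; proj₁; proj₂; Σ)
open import Data.List using (List; filter; foldr; length)
open import Data.List.Base using (allFin)
open import Relation.Nullary.Decidable using (_⊎-dec_)
open import Relation.Binary.PropositionalEquality using (_≡_)
open import Function.Bundles using (_⤖_; Bijection)

record Graph : Set where
  field
    nV   : ℕ
    nE   : ℕ
    ends : Fin nE → Fin nV × Fin nV

module _ (G : Graph) where
  open Graph G

  Incident : Fin nV → Fin nE → Set
  Incident v e = v ≡ proj₁ (ends e) ⊎ v ≡ proj₂ (ends e)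

  incidentEdges : Fin nV → List (Fin nE)
  incidentEdges v = filter (λ e → (v ≟ proj₁ (ends e)) ⊎-dec (v ≟ proj₂ (ends e))) (allFin nE)

  degree : Fin nV → ℕ
  degree v = length (incidentEdges v)

  -- A labeling of vertices and edges by 1..|V|+|E|, given as a bijection
  -- V ⊎ E ≅ Fin (|V|+|E|); the label of x is 1 + (index of x).
  label : ((Fin nV ⊎ Fin nE) ⤖ Fin (nV + nE)) → Fin nV ⊎ Fin nE → ℕ
  label b x = suc (toℕ (to x)) where open Bijection b

  edgeGcd : ((Fin nV ⊎ Fin nE) ⤖ Fin (nV + nE)) → Fin nV → ℕ
  edgeGcd b v = foldr (λ e g → gcd (label b (inj₂ e)) g) 0 (incidentEdges v)

  IsTotalPrimeLabeling : ((Fin nV ⊎ Fin nE) ⤖ Fin (nV + nE)) → Set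
  IsTotalPrimeLabeling b =
    ((e : Fin nE) → Coprime (label b (inj₁ (proj₁ (ends e)))) (label b (inj₁ (proj₂ (ends e)))))
    × ((v : Fin nV) → 2 ≤ degree v → edgeGcd b v ≡ 1)

  TotalPrime : Set
  TotalPrime = Σ ((Fin nV ⊎ Fin nE) ⤖ Fin (nV + nE)) IsTotalPrimeLabeling

next : ∀ {n} → Fin n → Fin n
next {suc k} i = suc (toℕ i) mod suc k

-- Vertices Fin (1 + (n + n)): hub = 0, rim i = 1 + i, pendant i = 1 + n + i.
-- Edges Fin (n + (n + n)): spoke i (hub–rim i), cycle edge i (rim i – rim (i+1 mod n)),
-- pendant edge i (rim i – pendant i).
module _ (n : ℕ) where
  hub : Fin (suc (n + n))
  hub = F.zero

  rim : Fin n → Fin (suc (n + n))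
  rim i = F.suc (i ↑ˡ n)

  pend : Fin n → Fin (suc (n + n))
  pend i = F.suc (n ↑ʳ i)

  helmEnds : Fin (n + (n + n)) → Fin (suc (n + n)) × Fin (suc (n + n))
  helmEnds e with splitAt n e
  ... | inj₁ i = hub , rim i
  ... | inj₂ e' with splitAt n e'
  ...   | inj₁ i = rim i , rim (next i)
  ...   | inj₂ i = rim i , pend i

helm : ℕ → Graph
helm n = record { nV = suc (n + n) ; nE = n + (n + n) ; ends = helmEnds n }

-- Label the hub 1, the rim/pendant pairs (rim i, pend i) with (2, 3), (5, 4), (7, 6), …, (2n+1, 2n),
-- and the edges with 2n+2, 2n+3, … in the order spokes, cycle edges, pendant edges.
-- Around the rim the labels run 2, 5, 7, …, 2n+1: neighbours are 2 and an odd number, or two odd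
-- numbers differing by 2, hence coprime; a rim vertex and its pendant carry consecutive labels.
-- Every vertex of degree at least 2 meets two edges with consecutive labels: the hub meets the
-- first two spokes, rim i > 0 the cycle edges i-1 and i, and rim 0 the last cycle edge and the
-- first pendant edge.  Pendant vertices have degree 1.
module Submission where

open import Defs
open import Data.Nat using (ℕ; zero; suc; _+_; _*_; _%_; _≤_; z≤n; s≤s)
open import Data.Nat.Properties using (+-comm; +-suc; ≤⇒≯)
open import Data.Nat.Tactic.RingSolver using (solve-∀)
open import Data.Nat.GCD using (gcd; gcd[m,n]∣m; gcd[m,n]∣n)
open import Data.Nat.Divisibility using (_∣_; ∣-trans; ∣1⇒≡1; ∣m+n∣m⇒∣n; ∣m⇒∣m*n)
open import Data.Nat.Coprimality as Coprimality using (Coprime; 1-coprimeTo; gcd≡1⇒coprime)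
open import Data.Nat.DivMod using (m<n⇒m%n≡m; n%n≡0)
open import Data.Fin as F using (Fin; toℕ; fromℕ; inject₁; combine; join; splitAt; _↑ˡ_; _↑ʳ_; _≟_)
open import Data.Fin.Patterns using (0F; 1F)
open import Data.Fin.Properties
  using (toℕ-injective; suc-injective; ↑ʳ-injective; toℕ-↑ˡ; toℕ-↑ʳ; toℕ-cast; toℕ-fromℕ; toℕ-fromℕ<
        ; toℕ-inject₁; toℕ<n; toℕ-combine; splitAt-↑ˡ; splitAt-↑ʳ; splitAt-join; join-splitAt; splitAt⁻¹-↑ʳ
        ; +↔⊎; *↔×)
open import Data.Fin.Permutation using (Permutation′; _⟨$⟩ʳ_; lift₀; cast-id)
open import Data.Fin.Relation.Unary.Top using (View; view; ‵fromℕ; ‵inject₁)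
open import Data.Sum using (_⊎_; inj₁; inj₂; [_,_])
open import Data.Sum.Function.Propositional using (_⊎-↔_)
open import Data.Product using (_×_; _,_; proj₁; proj₂; uncurry)
open import Data.List using ([]; _∷_; foldr; length; allFin)
open import Data.List.Membership.Propositional using (_∈_)
open import Data.List.Membership.Propositional.Properties using (∈-filter⁺; ∈-allFin)
open import Data.List.Relation.Unary.Any using (here; there)
open import Data.List.Relation.Unary.All as All using (All; _∷_)
open import Data.List.Relation.Unary.All.Properties using (all-filter)
open import Data.List.Relation.Unary.AllPairs using (_∷_)
open import Data.List.Relation.Unary.Unique.Propositional using (Unique)
open import Data.List.Relation.Unary.Unique.Propositional.Properties using (allFin⁺; filter⁺)
open import Data.Empty using (⊥-elim)
open import Function using (_∘_)
open import Function.Bundles using (_↔_; _⤖_; mk↔ₛ′)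
open import Function.Construct.Composition using (_↔-∘_)
open import Function.Construct.Identity using (↔-id)
open import Function.Construct.Symmetry using (↔-sym)
open import Function.Properties.Inverse using (↔⇒⤖)
open import Relation.Nullary using (contradiction)
open import Relation.Nullary.Decidable using (_⊎-dec_)
open import Relation.Unary using (Decidable)
open import Relation.Binary.PropositionalEquality
  using (_≡_; _≢_; refl; sym; trans; cong; subst; subst₂; module ≡-Reasoning)

open Graph using (nV; nE)

coprime-suc : ∀ n → Coprime n (suc n)
coprime-suc n {d} (d∣n , d∣1+n) = ∣1⇒≡1 (∣m+n∣m⇒∣n (subst (d ∣_) (+-comm 1 n) d∣1+n) d∣n)

odd-coprime-2 : ∀ m → Coprime (2 * m + 1) 2
odd-coprime-2 m (d∣2m+1 , d∣2) = ∣1⇒≡1 (∣m+n∣m⇒∣n d∣2m+1 (∣m⇒∣m*n m d∣2))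

coprime-+2 : ∀ {m} → Coprime m 2 → Coprime m (m + 2)
coprime-+2 m⊥2 (d∣m , d∣m+2) = m⊥2 (d∣m , ∣m+n∣m⇒∣n d∣m+2 d∣m)

foldr-gcd-∣ : ∀ {A : Set} (f : A → ℕ) {xs x} → x ∈ xs → foldr (λ y g → gcd (f y) g) 0 xs ∣ f x
foldr-gcd-∣ f {y ∷ _} (here refl)  = gcd[m,n]∣m (f y) _
foldr-gcd-∣ f {y ∷ _} (there x∈xs) = ∣-trans (gcd[m,n]∣n (f y) _) (foldr-gcd-∣ f x∈xs)

foldr-gcd≡1 : ∀ {A : Set} (f : A → ℕ) {xs x y} → x ∈ xs → y ∈ xs → Coprime (f x) (f y) →
              foldr (λ z g → gcd (f z) g) 0 xs ≡ 1
foldr-gcd≡1 f x∈xs y∈xs fx⊥fy = fx⊥fy (foldr-gcd-∣ f x∈xs , foldr-gcd-∣ f y∈xs)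

Unique-All≡⇒length≤1 : ∀ {A : Set} {c : A} {xs} → Unique xs → All (_≡ c) xs → length xs ≤ 1
Unique-All≡⇒length≤1 {xs = []}        _               _               = z≤n
Unique-All≡⇒length≤1 {xs = _ ∷ []}    _               _               = s≤s z≤n
Unique-All≡⇒length≤1 {xs = _ ∷ _ ∷ _} ((x≢y ∷ _) ∷ _) (x≡c ∷ y≡c ∷ _) = ⊥-elim (x≢y (trans x≡c (sym y≡c)))

module _ (G : Graph) where
  open Graph G using (ends)

  incident? : ∀ v → Decidable (Incident G v)
  incident? v e = (v ≟ proj₁ (ends e)) ⊎-dec (v ≟ proj₂ (ends e))

  ∈-incidentEdges : ∀ {v e} → Incident G v e → e ∈ incidentEdges G v
  ∈-incidentEdges {v} {e} = ∈-filter⁺ (incident? v) (∈-allFin e)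

  edgeGcd≡1 : ∀ b {v e e′} → Incident G v e → Incident G v e′ →
              Coprime (label G b (inj₂ e)) (label G b (inj₂ e′)) → edgeGcd G b v ≡ 1
  edgeGcd≡1 b v∼e v∼e′ = foldr-gcd≡1 (label G b ∘ inj₂) (∈-incidentEdges v∼e) (∈-incidentEdges v∼e′)

  degree≤1 : ∀ {v} c → (∀ {e} → Incident G v e → e ≡ c) → degree G v ≤ 1
  degree≤1 {v} c only-c = Unique-All≡⇒length≤1
    (filter⁺ (incident? v) (allFin⁺ (nE G)))
    (All.map only-c (all-filter (incident? v) (allFin (nE G))))

next-fromℕ : ∀ m → next (fromℕ m) ≡ 0F
next-fromℕ m = toℕ-injective (begin
  toℕ (next (fromℕ m))      ≡⟨ toℕ-fromℕ< _ ⟩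
  suc (toℕ (fromℕ m)) % suc m ≡⟨ cong (λ t → suc t % suc m) (toℕ-fromℕ m) ⟩
  suc m % suc m             ≡⟨ n%n≡0 (suc m) ⟩
  0                         ∎)
  where open ≡-Reasoning

next-inject₁ : ∀ {m} (j : Fin m) → next (inject₁ j) ≡ F.suc j
next-inject₁ {m} j = toℕ-injective (begin
  toℕ (next (inject₁ j))        ≡⟨ toℕ-fromℕ< _ ⟩
  suc (toℕ (inject₁ j)) % suc m ≡⟨ cong (λ t → suc t % suc m) (toℕ-inject₁ j) ⟩
  suc (toℕ j) % suc m           ≡⟨ m<n⇒m%n≡m (s≤s (toℕ<n j)) ⟩
  suc (toℕ j)                   ∎)
  where open ≡-Reasoning

rimLabel pendLabel : ℕ → ℕ
rimLabel zero     = 2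
rimLabel (suc i)  = 2 * i + 5
pendLabel zero    = 3
pendLabel (suc i) = 2 * i + 4

rimLabel-coprime-pendLabel : ∀ i → Coprime (rimLabel i) (pendLabel i)
rimLabel-coprime-pendLabel zero    = coprime-suc 2
rimLabel-coprime-pendLabel (suc i) =
  Coprimality.sym (subst (Coprime _) (sym (+-suc (2 * i) 4)) (coprime-suc (2 * i + 4)))

rimLabel-suc-coprime-2 : ∀ i → Coprime (rimLabel (suc i)) 2
rimLabel-suc-coprime-2 i = subst (λ r → Coprime r 2) (odd i) (odd-coprime-2 (i + 2))
  where
  odd : ∀ i → 2 * (i + 2) + 1 ≡ 2 * i + 5
  odd = solve-∀

rimLabel-coprime-suc : ∀ i → Coprime (rimLabel i) (rimLabel (suc i))
rimLabel-coprime-suc zero    = gcd≡1⇒coprime refl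
rimLabel-coprime-suc (suc i) = subst (Coprime _) (sym (step i)) (coprime-+2 (rimLabel-suc-coprime-2 i))
  where
  step : ∀ i → 2 * suc i + 5 ≡ 2 * i + 5 + 2
  step = solve-∀

rimLabel-coprime-next : ∀ m (k : Fin (2 + m)) → Coprime (rimLabel (toℕ k)) (rimLabel (toℕ (next k)))
rimLabel-coprime-next m k = go (view k)
  where
  RimsCoprime : ℕ → ℕ → Set
  RimsCoprime a b = Coprime (rimLabel a) (rimLabel b)

  go : ∀ {k : Fin (2 + m)} → View k → RimsCoprime (toℕ k) (toℕ (next k))
  go ‵fromℕ       = subst₂ RimsCoprime (sym (toℕ-fromℕ (suc m))) (cong toℕ (sym (next-fromℕ (suc m))))
                      (rimLabel-suc-coprime-2 m)
  go (‵inject₁ j) = subst₂ RimsCoprime (sym (toℕ-inject₁ j)) (cong toℕ (sym (next-inject₁ j)))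
                      (rimLabel-coprime-suc (toℕ j))

-- Interleaves rims (inj₁) and pendants (inj₂) as k ↦ (k , bit), except that rim 0 takes the even
-- slot: with all rims on odd slots the labels 3 and 2n+1 of rim 0 and rim (n-1) may share a factor.
twist : ∀ {n} → Fin n ⊎ Fin n → Fin n × Fin 2
twist (inj₁ 0F)        = 0F , 0F
twist (inj₁ (F.suc k)) = F.suc k , 1F
twist (inj₂ 0F)        = 0F , 1F
twist (inj₂ (F.suc k)) = F.suc k , 0F

untwist : ∀ {n} → Fin n × Fin 2 → Fin n ⊎ Fin n
untwist (0F , 0F)      = inj₁ 0F
untwist (0F , 1F)      = inj₂ 0F
untwist (F.suc k , 0F) = inj₂ (F.suc k)
untwist (F.suc k , 1F) = inj₁ (F.suc k)

twist↔ : ∀ {n} → (Fin n ⊎ Fin n) ↔ (Fin n × Fin 2)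
twist↔ = mk↔ₛ′ twist untwist twist-untwist untwist-twist
  where
  twist-untwist : ∀ p → twist (untwist p) ≡ p
  twist-untwist (0F , 0F)      = refl
  twist-untwist (0F , 1F)      = refl
  twist-untwist (F.suc k , 0F) = refl
  twist-untwist (F.suc k , 1F) = refl

  untwist-twist : ∀ x → untwist (twist x) ≡ x
  untwist-twist (inj₁ 0F)        = refl
  untwist-twist (inj₁ (F.suc k)) = refl
  untwist-twist (inj₂ 0F)        = refl
  untwist-twist (inj₂ (F.suc k)) = refl

2+toℕ-twist-inj₁ : ∀ {n} (k : Fin n) → 2 + toℕ (uncurry combine (twist (inj₁ k))) ≡ rimLabel (toℕ k)
2+toℕ-twist-inj₁ 0F        = refl
2+toℕ-twist-inj₁ (F.suc k) = trans (cong (2 +_) (toℕ-combine (F.suc k) 1F)) (shape (toℕ k))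
  where
  shape : ∀ t → 2 + (2 * suc t + 1) ≡ 2 * t + 5
  shape = solve-∀

2+toℕ-twist-inj₂ : ∀ {n} (k : Fin n) → 2 + toℕ (uncurry combine (twist (inj₂ k))) ≡ pendLabel (toℕ k)
2+toℕ-twist-inj₂ 0F        = refl
2+toℕ-twist-inj₂ (F.suc k) = trans (cong (2 +_) (toℕ-combine (F.suc k) 0F)) (shape (toℕ k))
  where
  shape : ∀ t → 2 + (2 * suc t + 0) ≡ 2 * t + 4
  shape = solve-∀

n*2≡n+n : ∀ n → n * 2 ≡ n + n
n*2≡n+n = solve-∀

interleave : ∀ n → Permutation′ (n + n)
interleave n = cast-id (n*2≡n+n n) ↔-∘ (↔-sym (*↔× {n} {2}) ↔-∘ (twist↔ ↔-∘ +↔⊎ {n} {n}))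

toℕ-interleave : ∀ n x → toℕ (interleave n ⟨$⟩ʳ join n n x) ≡ toℕ (uncurry combine (twist x))
toℕ-interleave n x =
  trans (toℕ-cast {n * 2} (n*2≡n+n n) _) (cong (toℕ ∘ uncurry combine ∘ twist) (splitAt-join n n x))

helmLabelling : ∀ n → (Fin (nV (helm n)) ⊎ Fin (nE (helm n))) ⤖ Fin (nV (helm n) + nE (helm n))
helmLabelling n = ↔⇒⤖ (↔-sym +↔⊎ ↔-∘ (lift₀ (interleave n) ⊎-↔ ↔-id _))

cycleEdge pendantEdge : ∀ n → Fin n → Fin (nE (helm n))
cycleEdge n k   = n ↑ʳ (k ↑ˡ n)
pendantEdge n k = n ↑ʳ (n ↑ʳ k)

module _ (n : ℕ) where
  open ≡-Reasoning

  label-rim : ∀ k → label (helm n) (helmLabelling n) (inj₁ (rim n k)) ≡ rimLabel (toℕ k)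
  label-rim k = begin
    2 + toℕ ((interleave n ⟨$⟩ʳ (k ↑ˡ n)) ↑ˡ nE (helm n)) ≡⟨ cong (2 +_) (toℕ-↑ˡ _ _) ⟩
    2 + toℕ (interleave n ⟨$⟩ʳ join n n (inj₁ k))        ≡⟨ cong (2 +_) (toℕ-interleave n (inj₁ k)) ⟩
    2 + toℕ (uncurry combine (twist (inj₁ k)))           ≡⟨ 2+toℕ-twist-inj₁ k ⟩
    rimLabel (toℕ k)                                     ∎

  label-pend : ∀ k → label (helm n) (helmLabelling n) (inj₁ (pend n k)) ≡ pendLabel (toℕ k)
  label-pend k = begin
    2 + toℕ ((interleave n ⟨$⟩ʳ (n ↑ʳ k)) ↑ˡ nE (helm n)) ≡⟨ cong (2 +_) (toℕ-↑ˡ _ _) ⟩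
    2 + toℕ (interleave n ⟨$⟩ʳ join n n (inj₂ k))        ≡⟨ cong (2 +_) (toℕ-interleave n (inj₂ k)) ⟩
    2 + toℕ (uncurry combine (twist (inj₂ k)))           ≡⟨ 2+toℕ-twist-inj₂ k ⟩
    pendLabel (toℕ k)                                    ∎

  label-edge : ∀ e → label (helm n) (helmLabelling n) (inj₂ e) ≡ suc (nV (helm n) + toℕ e)
  label-edge e = cong suc (toℕ-↑ʳ (nV (helm n)) e)

  edgeLabels-coprime : ∀ {e e′} → toℕ e′ ≡ suc (toℕ e) →
                       Coprime (label (helm n) (helmLabelling n) (inj₂ e)) (label (helm n) (helmLabelling n) (inj₂ e′))
  edgeLabels-coprime {e} {e′} e′≡1+e =
    subst₂ Coprime (sym (label-edge e)) (sym label-e′) (coprime-suc (suc (nV (helm n) + toℕ e)))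
    where
    label-e′ : label (helm n) (helmLabelling n) (inj₂ e′) ≡ suc (suc (nV (helm n) + toℕ e))
    label-e′ = begin
      label (helm n) (helmLabelling n) (inj₂ e′) ≡⟨ label-edge e′ ⟩
      suc (nV (helm n) + toℕ e′)                 ≡⟨ cong (λ t → suc (nV (helm n) + t)) e′≡1+e ⟩
      suc (nV (helm n) + suc (toℕ e))            ≡⟨ cong suc (+-suc (nV (helm n)) (toℕ e)) ⟩
      suc (suc (nV (helm n) + toℕ e))            ∎

  consecutiveEdges⇒edgeGcd≡1 : ∀ {v e e′} → Incident (helm n) v e → Incident (helm n) v e′ →
                               toℕ e′ ≡ suc (toℕ e) → edgeGcd (helm n) (helmLabelling n) v ≡ 1
  consecutiveEdges⇒edgeGcd≡1 v∼e v∼e′ e′≡1+e =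
    edgeGcd≡1 (helm n) (helmLabelling n) v∼e v∼e′ (edgeLabels-coprime e′≡1+e)

  toℕ-cycleEdge : ∀ k → toℕ (cycleEdge n k) ≡ n + toℕ k
  toℕ-cycleEdge k = trans (toℕ-↑ʳ n (k ↑ˡ n)) (cong (n +_) (toℕ-↑ˡ k n))

  toℕ-pendantEdge : ∀ k → toℕ (pendantEdge n k) ≡ n + (n + toℕ k)
  toℕ-pendantEdge k = trans (toℕ-↑ʳ n (n ↑ʳ k)) (cong (n +_) (toℕ-↑ʳ n k))

  helmEnds-cycleEdge : ∀ k → helmEnds n (cycleEdge n k) ≡ (rim n k , rim n (next k))
  helmEnds-cycleEdge k rewrite splitAt-↑ʳ n (n + n) (k ↑ˡ n) | splitAt-↑ˡ n k n = refl

  helmEnds-pendantEdge : ∀ k → helmEnds n (pendantEdge n k) ≡ (rim n k , pend n k)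
  helmEnds-pendantEdge k rewrite splitAt-↑ʳ n (n + n) (n ↑ʳ k) | splitAt-↑ʳ n n k = refl

  rim∼cycleEdge : ∀ k → Incident (helm n) (rim n k) (cycleEdge n k)
  rim∼cycleEdge k = inj₁ (cong proj₁ (sym (helmEnds-cycleEdge k)))

  rim-next∼cycleEdge : ∀ k → Incident (helm n) (rim n (next k)) (cycleEdge n k)
  rim-next∼cycleEdge k = inj₂ (cong proj₂ (sym (helmEnds-cycleEdge k)))

  rim∼pendantEdge : ∀ k → Incident (helm n) (rim n k) (pendantEdge n k)
  rim∼pendantEdge k = inj₁ (cong proj₁ (sym (helmEnds-pendantEdge k)))

  helmEnds-elim : ∀ {P : Fin (nV (helm n)) × Fin (nV (helm n)) → Set} →
                  (∀ k → P (hub n , rim n k)) → (∀ k → P (rim n k , rim n (next k))) →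
                  (∀ k → P (rim n k , pend n k)) → ∀ e → P (helmEnds n e)
  helmEnds-elim spoke cycle pendant e with splitAt n e
  ... | inj₁ k = spoke k
  ... | inj₂ e′ with splitAt n e′
  ...   | inj₁ k = cycle k
  ...   | inj₂ k = pendant k

  rim≢pend : ∀ j k → rim n j ≢ pend n k
  rim≢pend j k rim≡pend = inj₁≢inj₂ (begin
    inj₁ j             ≡⟨ splitAt-↑ˡ n j n ⟨
    splitAt n (j ↑ˡ n) ≡⟨ cong (splitAt n) (suc-injective rim≡pend) ⟩
    splitAt n (n ↑ʳ k) ≡⟨ splitAt-↑ʳ n n k ⟩
    inj₂ k             ∎)
    where
    inj₁≢inj₂ : inj₁ j ≢ inj₂ k
    inj₁≢inj₂ ()

  pend-incident⇒pendantEdge : ∀ k {e} → Incident (helm n) (pend n k) e → e ≡ pendantEdge n k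
  pend-incident⇒pendantEdge k {e} pend∼e with splitAt n e in eq
  ... | inj₁ j = ⊥-elim ([ (λ ()) , rim≢pend j k ∘ sym ] pend∼e)
  ... | inj₂ e′ with splitAt n e′ in eq′
  ...   | inj₁ j = ⊥-elim ([ rim≢pend j k ∘ sym , rim≢pend (next j) k ∘ sym ] pend∼e)
  ...   | inj₂ j = [ ⊥-elim ∘ rim≢pend j k ∘ sym , e≡pendantEdge ] pend∼e
    where
    e≡pendantEdge : pend n k ≡ pend n j → e ≡ pendantEdge n k
    e≡pendantEdge pendk≡pendj = begin
      e             ≡⟨ splitAt⁻¹-↑ʳ eq ⟨
      n ↑ʳ e′       ≡⟨ cong (n ↑ʳ_) (splitAt⁻¹-↑ʳ eq′) ⟨
      n ↑ʳ (n ↑ʳ j) ≡⟨ cong (pendantEdge n) (↑ʳ-injective n j k (suc-injective (sym pendk≡pendj))) ⟩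
      n ↑ʳ (n ↑ʳ k) ∎

  pend-degree≤1 : ∀ k → degree (helm n) (pend n k) ≤ 1
  pend-degree≤1 k = degree≤1 (helm n) (pendantEdge n k) (pend-incident⇒pendantEdge k)

data HelmVertex (n : ℕ) : Fin (nV (helm n)) → Set where
  ‵hub  : HelmVertex n (hub n)
  ‵rim  : ∀ k → HelmVertex n (rim n k)
  ‵pend : ∀ k → HelmVertex n (pend n k)

helmVertex : ∀ n v → HelmVertex n v
helmVertex n 0F        = ‵hub
helmVertex n (F.suc v) = subst (HelmVertex n ∘ F.suc) (join-splitAt n n v) (fromSplit (splitAt n v))
  where
  fromSplit : ∀ s → HelmVertex n (F.suc (join n n s))
  fromSplit (inj₁ k) = ‵rim k
  fromSplit (inj₂ k) = ‵pend k

rim-edgeGcd≡1 : ∀ m k → edgeGcd (helm (suc m)) (helmLabelling (suc m)) (rim (suc m) k) ≡ 1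
rim-edgeGcd≡1 m 0F = consecutiveEdges⇒edgeGcd≡1 n
  (subst (λ r → Incident (helm n) (rim n r) (cycleEdge n (fromℕ m))) (next-fromℕ m) (rim-next∼cycleEdge n (fromℕ m)))
  (rim∼pendantEdge n 0F)
  (begin
    toℕ (pendantEdge n 0F)            ≡⟨ toℕ-pendantEdge n 0F ⟩
    n + (n + 0)                       ≡⟨ shape m ⟩
    suc (n + m)                       ≡⟨ cong (suc ∘ (n +_)) (toℕ-fromℕ m) ⟨
    suc (n + toℕ (fromℕ m))           ≡⟨ cong suc (toℕ-cycleEdge n (fromℕ m)) ⟨
    suc (toℕ (cycleEdge n (fromℕ m))) ∎)
  where
  n = suc m
  open ≡-Reasoning
  shape : ∀ m → suc m + (suc m + 0) ≡ suc (suc m + m)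
  shape = solve-∀
rim-edgeGcd≡1 m (F.suc j) = consecutiveEdges⇒edgeGcd≡1 n
  (subst (λ r → Incident (helm n) (rim n r) (cycleEdge n (inject₁ j))) (next-inject₁ j) (rim-next∼cycleEdge n (inject₁ j)))
  (rim∼cycleEdge n (F.suc j))
  (begin
    toℕ (cycleEdge n (F.suc j))         ≡⟨ toℕ-cycleEdge n (F.suc j) ⟩
    n + suc (toℕ j)                     ≡⟨ +-suc n (toℕ j) ⟩
    suc (n + toℕ j)                     ≡⟨ cong (suc ∘ (n +_)) (toℕ-inject₁ j) ⟨
    suc (n + toℕ (inject₁ j))           ≡⟨ cong suc (toℕ-cycleEdge n (inject₁ j)) ⟨
    suc (toℕ (cycleEdge n (inject₁ j))) ∎)
  where
  n = suc m
  open ≡-Reasoning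

module _ (m : ℕ) where
  private
    n = 2 + m
    vertexLabel = λ v → label (helm n) (helmLabelling n) (inj₁ v)

  helm-endpoints-coprime : ∀ e → Coprime (vertexLabel (proj₁ (helmEnds n e))) (vertexLabel (proj₂ (helmEnds n e)))
  helm-endpoints-coprime = helmEnds-elim n {P = λ (u , v) → Coprime (vertexLabel u) (vertexLabel v)}
    (λ k → 1-coprimeTo _)
    (λ k → subst₂ Coprime (sym (label-rim n k)) (sym (label-rim n (next k))) (rimLabel-coprime-next m k))
    (λ k → subst₂ Coprime (sym (label-rim n k)) (sym (label-pend n k)) (rimLabel-coprime-pendLabel (toℕ k)))

  helm-edgeGcd≡1 : ∀ v → 2 ≤ degree (helm n) v → edgeGcd (helm n) (helmLabelling n) v ≡ 1
  helm-edgeGcd≡1 v 2≤deg with helmVertex n v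
  ... | ‵hub    = consecutiveEdges⇒edgeGcd≡1 n {e = 0F} {e′ = 1F} (inj₁ refl) (inj₁ refl) refl
  ... | ‵rim k  = rim-edgeGcd≡1 (suc m) k
  ... | ‵pend k = contradiction 2≤deg (≤⇒≯ (pend-degree≤1 n k))

mainTheorem1 : (n : ℕ) → 3 ≤ n → TotalPrime (helm n)
mainTheorem1 (suc (suc m)) _ = helmLabelling (2 + m) , helm-endpoints-coprime m , helm-edgeGcd≡1 m
mainTheorem1 1 (s≤s ())
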